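{- Let $A$ be an independent set in $G(n,4,1)$, with $A_0=\{v_1,\dots,v_k\}$ and $A_2$ as defined in the context. Then $|A_2|\le 2k^2+o(n^2)$ as $n\to\infty$.
   Context: $G(n,4,1)$ is the graph whose vertex set is the family of all $4$-element subsets of $[n]=\{1,\dots,n\}$, two vertices being adjacent iff they intersect in exactly one element. Given an independent set $A$, let $A_0=\{v_1,\dots,v_k\}\subseteq A$ be a subfamily of maximum size among subfamilies of $A$ consisting of pairwise disjoint sets. $A_2$ is the set of $v\in A\setminus A_0$ that intersect exactly two of the sets $v_1,\dots,v_k$. -}

module Defs where

open import Data.Nat using (ℕ; _≤_; _≟_)
open import Data.Bool using (Bool)
import Data.Bool.Properties as BoolP
open import Data.Fin.Subset using (Subset; _∩_; ∣_∣)
open import Data.Vec.Properties using (≡-dec)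
open import Data.List using (List; length; filter)
open import Data.List.Membership.Propositional using (_∈_)
open import Data.List.Relation.Unary.All using (All)
open import Data.List.Relation.Unary.AllPairs using (AllPairs)
open import Data.List.Relation.Unary.Unique.Propositional using (Unique)
open import Data.Product using (_×_)
open import Relation.Binary.PropositionalEquality using (_≡_; _≢_)
open import Relation.Binary.Definitions using (DecidableEquality)
open import Relation.Nullary using (¬?)
open import Relation.Nullary.Decidable using (_×-dec_)
import Data.List.Membership.DecPropositional as DecMem

-- A vertex of G(n,4,1) is a subset of [n] = Fin n of size 4.
-- Two vertices u, v are adjacent iff |u ∩ v| = 1.

subset-≟ : ∀ {n} → DecidableEquality (Subset n)
subset-≟ = ≡-dec BoolP._≟_

-- A family of vertices (finite set, represented as a duplicate-free list
-- of 4-subsets of [n]).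
IsFamily : ∀ {n} → List (Subset n) → Set
IsFamily A = All (λ s → ∣ s ∣ ≡ 4) A × Unique A

Independent : ∀ {n} → List (Subset n) → Set
Independent A = ∀ {u v} → u ∈ A → v ∈ A → ∣ u ∩ v ∣ ≢ 1

SubfamilyOf : ∀ {n} → List (Subset n) → List (Subset n) → Set
SubfamilyOf B A = Unique B × (∀ {x} → x ∈ B → x ∈ A)

PairwiseDisjoint : ∀ {n} → List (Subset n) → Set
PairwiseDisjoint B = AllPairs (λ u v → ∣ u ∩ v ∣ ≡ 0) B

IsMaxDisjoint : ∀ {n} → List (Subset n) → List (Subset n) → Set
IsMaxDisjoint A0 A =
  SubfamilyOf A0 A × PairwiseDisjoint A0 ×
  (∀ B → SubfamilyOf B A → PairwiseDisjoint B → length B ≤ length A0)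

hits : ∀ {n} → Subset n → List (Subset n) → ℕ
hits v A0 = length (filter (λ w → ¬? (∣ v ∩ w ∣ ≟ 0)) A0)

A₂ : ∀ {n} → List (Subset n) → List (Subset n) → List (Subset n)
A₂ {n} A A0 =
  filter (λ v → ¬? (v ∈? A0) ×-dec (hits v A0 ≟ 2)) A
  where open DecMem (subset-≟ {n}) using (_∈?_)

module Submission where

-- The bound |A₂| ≤ 2k² + 256k, together with 4k ≤ n, gives the theorem.
--
-- Every v ∈ A₂ meets exactly two members u, w of A₀, each in exactly two
-- points (an intersection of size 1 is forbidden by independence and the
-- sizes add up to at most |v| = 4), so v = (v ∩ u) ∪ (v ∩ w).  For each
-- u ∈ A₀ fix one representative r ∈ A₂ meeting u, and let x be the other
-- member of A₀ met by r.  For v with side u, either its other side is x,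
-- and then v lies inside the at most 8 points of u ∪ x (at most 256
-- choices per u), or the trace v ∩ u meets r ∩ u in 0 or 2 points, so by
-- independence v ∩ u is r ∩ u or its complement u ─ (r ∩ u).  If both
-- traces of v are of the latter "canonical" kind, v is one of the 4
-- unions of canonical traces of an unordered pair of members of A₀,
-- giving at most 4·k(k-1)/2 ≤ 2k² sets.  Since A₂ has no repetitions,
-- |A₂| is bounded by the length of the list of candidates.

open import Data.Nat using (ℕ; suc; _+_; _*_; _^_; _≤_; z≤n; s≤s; _≟_)
open import Data.Nat.Properties
open import Data.Nat.Tactic.RingSolver using (solve-∀)
open import Data.Vec using ([]; _∷_; here)
open import Data.Vec.Properties using (∷-injectiveʳ)
open import Data.Fin.Subset as S using (Subset; _∩_; _∪_; _─_; ∣_∣; ⊥; ⋃; _⊆_; inside; outside)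
open import Data.Fin.Subset.Properties
open import Data.List using (List; []; _∷_; _++_; map; length; filter; take; find; concatMap; cartesianProductWith)
open import Data.List.Properties using (length-++; length-map; length-take; take-all)
open import Data.List.Membership.Propositional using (_∈_; lose)
open import Data.List.Membership.Propositional.Properties
  using (∈-map⁺; ∈-++⁺ˡ; ∈-++⁺ʳ; ∈-filter⁺; ∈-filter⁻; ∈-concatMap⁺; ∈-cartesianProductWith⁺)
open import Data.List.Relation.Unary.Any using (Any; here; there)
open import Data.List.Relation.Unary.All as All using (All; []; _∷_)
import Data.List.Relation.Unary.All.Properties as AllP
open import Data.List.Relation.Unary.AllPairs using (AllPairs; []; _∷_)
open import Data.List.Relation.Unary.Unique.Propositional using (Unique)
import Data.List.Relation.Unary.Unique.Propositional.Properties as UniqueP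
open import Data.Maybe using (just; fromMaybe)
open import Data.Product using (_×_; _,_; ∃-syntax; proj₁; proj₂)
open import Data.Sum using (_⊎_; inj₁; inj₂)
import Data.Sum as Sum
open import Data.Empty using () renaming (⊥ to Empty; ⊥-elim to absurd)
open import Relation.Binary.PropositionalEquality
open import Relation.Nullary using (Dec; contradiction; yes; no; ¬?)
open import Level using (0ℓ)
open import Relation.Unary using (Pred; Decidable)
open import Defs

private variable n : ℕ

-- Cardinalities of subsets of Fin n.

∣p∣≡0⇒p≡⊥ : (p : Subset n) → ∣ p ∣ ≡ 0 → p ≡ ⊥
∣p∣≡0⇒p≡⊥ [] _ = refl
∣p∣≡0⇒p≡⊥ (outside ∷ p) e = cong (outside ∷_) (∣p∣≡0⇒p≡⊥ p e)

⊆∧∣q∣≤∣p∣⇒p≡q : (p q : Subset n) → p ⊆ q → ∣ q ∣ ≤ ∣ p ∣ → p ≡ q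
⊆∧∣q∣≤∣p∣⇒p≡q [] [] _ _ = refl
⊆∧∣q∣≤∣p∣⇒p≡q (inside ∷ p) (inside ∷ q) p⊆q c = cong (inside ∷_) (⊆∧∣q∣≤∣p∣⇒p≡q p q (drop-∷-⊆ p⊆q) (≤-pred c))
⊆∧∣q∣≤∣p∣⇒p≡q (outside ∷ p) (outside ∷ q) p⊆q c = cong (outside ∷_) (⊆∧∣q∣≤∣p∣⇒p≡q p q (drop-∷-⊆ p⊆q) c)
⊆∧∣q∣≤∣p∣⇒p≡q (inside ∷ p) (outside ∷ q) p⊆q c = contradiction (p⊆q here) λ ()
⊆∧∣q∣≤∣p∣⇒p≡q (outside ∷ p) (inside ∷ q) p⊆q c =
  contradiction (≤-trans c (p⊆q⇒∣p∣≤∣q∣ (drop-∷-⊆ p⊆q))) 1+n≰n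

p⊆q⇒p∩q≡p : (p q : Subset n) → p ⊆ q → p ∩ q ≡ p
p⊆q⇒p∩q≡p p q p⊆q = ⊆∧∣q∣≤∣p∣⇒p≡q (p ∩ q) p (p∩q⊆p p q) (p⊆q⇒∣p∣≤∣q∣ (λ x∈p → x∈p∩q⁺ (x∈p , p⊆q x∈p)))

∣p∩q∣≡∣p∣⇒p⊆q : (p q : Subset n) → ∣ p ∩ q ∣ ≡ ∣ p ∣ → p ⊆ q
∣p∩q∣≡∣p∣⇒p⊆q p q e =
  subst (_⊆ q) (⊆∧∣q∣≤∣p∣⇒p≡q (p ∩ q) p (p∩q⊆p p q) (≤-reflexive (sym e))) (p∩q⊆q p q)

∣p∩q∣+∣p─q∣≡∣p∣ : (p q : Subset n) → ∣ p ∩ q ∣ + ∣ p ─ q ∣ ≡ ∣ p ∣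
∣p∩q∣+∣p─q∣≡∣p∣ [] [] = refl
∣p∩q∣+∣p─q∣≡∣p∣ (inside ∷ p) (inside ∷ q) = cong suc (∣p∩q∣+∣p─q∣≡∣p∣ p q)
∣p∩q∣+∣p─q∣≡∣p∣ (inside ∷ p) (outside ∷ q) = trans (+-suc _ _) (cong suc (∣p∩q∣+∣p─q∣≡∣p∣ p q))
∣p∩q∣+∣p─q∣≡∣p∣ (outside ∷ p) (inside ∷ q) = ∣p∩q∣+∣p─q∣≡∣p∣ p q
∣p∩q∣+∣p─q∣≡∣p∣ (outside ∷ p) (outside ∷ q) = ∣p∩q∣+∣p─q∣≡∣p∣ p q

∣p∪q∣≤∣p∣+∣q∣ : (p q : Subset n) → ∣ p ∪ q ∣ ≤ ∣ p ∣ + ∣ q ∣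
∣p∪q∣≤∣p∣+∣q∣ [] [] = z≤n
∣p∪q∣≤∣p∣+∣q∣ (inside ∷ p) (inside ∷ q) = s≤s (≤-trans (∣p∪q∣≤∣p∣+∣q∣ p q) (+-monoʳ-≤ ∣ p ∣ (n≤1+n ∣ q ∣)))
∣p∪q∣≤∣p∣+∣q∣ (inside ∷ p) (outside ∷ q) = s≤s (∣p∪q∣≤∣p∣+∣q∣ p q)
∣p∪q∣≤∣p∣+∣q∣ (outside ∷ p) (inside ∷ q) = ≤-trans (s≤s (∣p∪q∣≤∣p∣+∣q∣ p q)) (≤-reflexive (sym (+-suc _ _)))
∣p∪q∣≤∣p∣+∣q∣ (outside ∷ p) (outside ∷ q) = ∣p∪q∣≤∣p∣+∣q∣ p q

∣p∪q∣≡∣p∣+∣q∣ : (p q : Subset n) → p ∩ q ≡ ⊥ → ∣ p ∪ q ∣ ≡ ∣ p ∣ + ∣ q ∣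
∣p∪q∣≡∣p∣+∣q∣ [] [] _ = refl
∣p∪q∣≡∣p∣+∣q∣ (inside ∷ p) (outside ∷ q) e = cong suc (∣p∪q∣≡∣p∣+∣q∣ p q (∷-injectiveʳ e))
∣p∪q∣≡∣p∣+∣q∣ (outside ∷ p) (inside ∷ q) e = trans (cong suc (∣p∪q∣≡∣p∣+∣q∣ p q (∷-injectiveʳ e))) (sym (+-suc _ _))
∣p∪q∣≡∣p∣+∣q∣ (outside ∷ p) (outside ∷ q) e = ∣p∪q∣≡∣p∣+∣q∣ p q (∷-injectiveʳ e)
∣p∪q∣≡∣p∣+∣q∣ (inside ∷ p) (inside ∷ q) ()

∣v∩u∣+∣v∩w∣≡∣v∩[u∪w]∣ : (v u w : Subset n) → u ∩ w ≡ ⊥ → ∣ v ∩ u ∣ + ∣ v ∩ w ∣ ≡ ∣ v ∩ (u ∪ w) ∣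
∣v∩u∣+∣v∩w∣≡∣v∩[u∪w]∣ v u w u∩w≡⊥ = begin
  ∣ v ∩ u ∣ + ∣ v ∩ w ∣        ≡⟨ sym (∣p∪q∣≡∣p∣+∣q∣ (v ∩ u) (v ∩ w) traces-disjoint) ⟩
  ∣ (v ∩ u) ∪ (v ∩ w) ∣        ≡⟨ cong ∣_∣ (sym (∩-distribˡ-∪ v u w)) ⟩
  ∣ v ∩ (u ∪ w) ∣              ∎
  where
  open ≡-Reasoning
  traces-disjoint : (v ∩ u) ∩ (v ∩ w) ≡ ⊥
  traces-disjoint = ⊆-antisym
    (λ h → subst (_ S.∈_) u∩w≡⊥ (x∈p∩q⁺ (p∩q⊆q v u (p∩q⊆p _ _ h) , p∩q⊆q v w (p∩q⊆q _ _ h))))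
    ⊥⊆

two-subsets : (u P Q : Subset n) → P ⊆ u → Q ⊆ u → ∣ u ∣ ≡ 4 → ∣ P ∣ ≡ 2 → ∣ Q ∣ ≡ 2 →
              ∣ P ∩ Q ∣ ≢ 1 → P ≡ Q ⊎ P ≡ u ─ Q
two-subsets u P Q P⊆u Q⊆u ∣u∣≡4 ∣P∣≡2 ∣Q∣≡2 ≢1 with ∣ P ∩ Q ∣ in eq | ∣p∩q∣≤∣p∣ P Q
... | 1 | _ = contradiction refl ≢1
... | suc (suc (suc _)) | le = absurd (3≰2 (subst (_ ≤_) ∣P∣≡2 le))
  where
  3≰2 : ∀ {k} → suc (suc (suc k)) ≤ 2 → Empty
  3≰2 (s≤s (s≤s ()))
... | 2 | _ = inj₁ (⊆-antisym
  (∣p∩q∣≡∣p∣⇒p⊆q P Q (trans eq (sym ∣P∣≡2)))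
  (∣p∩q∣≡∣p∣⇒p⊆q Q P (trans (cong ∣_∣ (∩-comm Q P)) (trans eq (sym ∣Q∣≡2)))))
... | 0 | _ = inj₂ (⊆∧∣q∣≤∣p∣⇒p≡q P (u ─ Q) P⊆u─Q (≤-reflexive (trans ∣u─Q∣≡2 (sym ∣P∣≡2))))
  where
  P⊆u─Q : P ⊆ u ─ Q
  P⊆u─Q {x} x∈P = x∈p∧x∉q⇒x∈p─q (P⊆u x∈P)
    (λ x∈Q → ∉⊥ (subst (x S.∈_) (∣p∣≡0⇒p≡⊥ (P ∩ Q) eq) (x∈p∩q⁺ (x∈P , x∈Q))))
  ∣u∩Q∣≡2 : ∣ u ∩ Q ∣ ≡ 2
  ∣u∩Q∣≡2 = trans (cong ∣_∣ (trans (∩-comm u Q) (p⊆q⇒p∩q≡p Q u Q⊆u))) ∣Q∣≡2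
  ∣u─Q∣≡2 : ∣ u ─ Q ∣ ≡ 2
  ∣u─Q∣≡2 = +-cancelˡ-≡ 2 _ _ (trans (cong (_+ ∣ u ─ Q ∣) (sym ∣u∩Q∣≡2)) (trans (∣p∩q∣+∣p─q∣≡∣p∣ u Q) ∣u∣≡4))

traces-cover : (v u w : Subset n) → v ⊆ u ∪ w → v ≡ (v ∩ u) ∪ (v ∩ w)
traces-cover v u w v⊆u∪w = trans (sym (p⊆q⇒p∩q≡p v (u ∪ w) v⊆u∪w)) (∩-distribˡ-∪ v u w)

meet-inside : (v r u w x : Subset n) → v ⊆ u ∪ w → r ⊆ u ∪ x → w ∩ x ≡ ⊥ →
              (v ∩ u) ∩ (r ∩ u) ≡ v ∩ r
meet-inside v r u w x v⊆u∪w r⊆u∪x w∩x≡⊥ = ⊆-antisym forget restrict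
  where
  forget : (v ∩ u) ∩ (r ∩ u) ⊆ v ∩ r
  forget h = x∈p∩q⁺ (p∩q⊆p v u (p∩q⊆p _ _ h) , p∩q⊆p r u (p∩q⊆q _ _ h))
  restrict : v ∩ r ⊆ (v ∩ u) ∩ (r ∩ u)
  restrict {y} h with x∈p∩q⁻ v r h
  ... | y∈v , y∈r with x∈p∪q⁻ u w (v⊆u∪w y∈v) | x∈p∪q⁻ u x (r⊆u∪x y∈r)
  ...   | inj₁ y∈u | _ = x∈p∩q⁺ (x∈p∩q⁺ (y∈v , y∈u) , x∈p∩q⁺ (y∈r , y∈u))
  ...   | inj₂ _ | inj₁ y∈u = x∈p∩q⁺ (x∈p∩q⁺ (y∈v , y∈u) , x∈p∩q⁺ (y∈r , y∈u))
  ...   | inj₂ y∈w | inj₂ y∈x = absurd (∉⊥ (subst (y S.∈_) w∩x≡⊥ (x∈p∩q⁺ (y∈w , y∈x))))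

⊆⋃ : ∀ {s} (L : List (Subset n)) → s ∈ L → s ⊆ ⋃ L
⊆⋃ (s ∷ L) (here refl) = p⊆p∪q (⋃ L)
⊆⋃ (t ∷ L) (there s∈L) = ⊆-trans (⊆⋃ L s∈L) (q⊆p∪q t (⋃ L))

∣⋃∣≤ : ∀ {c} (L : List (Subset n)) → All (λ s → ∣ s ∣ ≤ c) L → ∣ ⋃ L ∣ ≤ c * length L
∣⋃∣≤ {n} [] _ = ≤-trans (≤-reflexive (∣⊥∣≡0 n)) z≤n
∣⋃∣≤ {c = c} (s ∷ L) (∣s∣≤c ∷ bounds) = begin
  ∣ s ∪ ⋃ L ∣          ≤⟨ ∣p∪q∣≤∣p∣+∣q∣ s (⋃ L) ⟩
  ∣ s ∣ + ∣ ⋃ L ∣      ≤⟨ +-mono-≤ ∣s∣≤c (∣⋃∣≤ L bounds) ⟩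
  c + c * length L    ≡⟨ sym (*-suc c (length L)) ⟩
  c * suc (length L)  ∎
  where open ≤-Reasoning

disjoint-⋃ : (s : Subset n) (L : List (Subset n)) → All (λ t → ∣ s ∩ t ∣ ≡ 0) L → s ∩ ⋃ L ≡ ⊥
disjoint-⋃ s [] _ = ∩-zeroʳ s
disjoint-⋃ s (t ∷ L) (∣s∩t∣≡0 ∷ rest) = begin
  s ∩ (t ∪ ⋃ L)          ≡⟨ ∩-distribˡ-∪ s t (⋃ L) ⟩
  (s ∩ t) ∪ (s ∩ ⋃ L)    ≡⟨ cong₂ _∪_ (∣p∣≡0⇒p≡⊥ (s ∩ t) ∣s∩t∣≡0) (disjoint-⋃ s L rest) ⟩
  ⊥ ∪ ⊥                  ≡⟨ ∪-identityˡ ⊥ ⟩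
  ⊥                      ∎
  where open ≡-Reasoning

∣⋃∣≡ : ∀ {c} (L : List (Subset n)) → PairwiseDisjoint L → All (λ s → ∣ s ∣ ≡ c) L →
       ∣ ⋃ L ∣ ≡ c * length L
∣⋃∣≡ {n} {c} [] _ _ = trans (∣⊥∣≡0 n) (sym (*-zeroʳ c))
∣⋃∣≡ {c = c} (s ∷ L) (s-disjoint ∷ disjoint) (∣s∣≡c ∷ sizes) = begin
  ∣ s ∪ ⋃ L ∣          ≡⟨ ∣p∪q∣≡∣p∣+∣q∣ s (⋃ L) (disjoint-⋃ s L s-disjoint) ⟩
  ∣ s ∣ + ∣ ⋃ L ∣      ≡⟨ cong₂ _+_ ∣s∣≡c (∣⋃∣≡ L disjoint sizes) ⟩
  c + c * length L    ≡⟨ sym (*-suc c (length L)) ⟩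
  c * suc (length L)  ∎
  where open ≡-Reasoning

disjoint-family-bound : ∀ {c} (L : List (Subset n)) → PairwiseDisjoint L → All (λ s → ∣ s ∣ ≡ c) L →
                        c * length L ≤ n
disjoint-family-bound L disjoint sizes = ≤-trans (≤-reflexive (sym (∣⋃∣≡ L disjoint sizes))) (∣p∣≤n (⋃ L))

subsetsOf : Subset n → List (Subset n)
subsetsOf [] = [] ∷ []
subsetsOf (inside ∷ s) = map (inside ∷_) (subsetsOf s) ++ map (outside ∷_) (subsetsOf s)
subsetsOf (outside ∷ s) = map (outside ∷_) (subsetsOf s)

length-subsetsOf : (s : Subset n) → length (subsetsOf s) ≡ 2 ^ ∣ s ∣
length-subsetsOf [] = refl
length-subsetsOf (inside ∷ s) = begin
  length (map (inside ∷_) (subsetsOf s) ++ map (outside ∷_) (subsetsOf s))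
    ≡⟨ length-++ (map (inside ∷_) (subsetsOf s)) ⟩
  length (map (inside ∷_) (subsetsOf s)) + length (map (outside ∷_) (subsetsOf s))
    ≡⟨ cong₂ _+_ (length-map _ (subsetsOf s)) (length-map _ (subsetsOf s)) ⟩
  length (subsetsOf s) + length (subsetsOf s)
    ≡⟨ cong₂ _+_ (length-subsetsOf s) (length-subsetsOf s) ⟩
  2 ^ ∣ s ∣ + 2 ^ ∣ s ∣
    ≡⟨ cong (2 ^ ∣ s ∣ +_) (sym (+-identityʳ _)) ⟩
  2 ^ suc ∣ s ∣ ∎
  where open ≡-Reasoning
length-subsetsOf (outside ∷ s) = trans (length-map _ (subsetsOf s)) (length-subsetsOf s)

∈-subsetsOf : (p s : Subset n) → p ⊆ s → p ∈ subsetsOf s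
∈-subsetsOf [] [] _ = here refl
∈-subsetsOf (inside ∷ p) (inside ∷ s) p⊆s =
  ∈-++⁺ˡ (∈-map⁺ (inside ∷_) (∈-subsetsOf p s (drop-∷-⊆ p⊆s)))
∈-subsetsOf (outside ∷ p) (inside ∷ s) p⊆s =
  ∈-++⁺ʳ (map (inside ∷_) (subsetsOf s)) (∈-map⁺ (outside ∷_) (∈-subsetsOf p s (drop-∷-⊆ p⊆s)))
∈-subsetsOf (outside ∷ p) (outside ∷ s) p⊆s = ∈-map⁺ (outside ∷_) (∈-subsetsOf p s (drop-∷-⊆ p⊆s))
∈-subsetsOf (inside ∷ p) (outside ∷ s) p⊆s = contradiction (p⊆s here) λ ()

-- Counting with lists.

module _ {X : Set} where

  delete : {x : X} (xs : List X) → x ∈ xs → List X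
  delete (_ ∷ xs) (here _) = xs
  delete (y ∷ xs) (there x∈xs) = y ∷ delete xs x∈xs

  length-delete : {x : X} (xs : List X) (x∈xs : x ∈ xs) → suc (length (delete xs x∈xs)) ≡ length xs
  length-delete (_ ∷ xs) (here _) = refl
  length-delete (y ∷ xs) (there x∈xs) = cong suc (length-delete xs x∈xs)

  ∈-delete : {x y : X} (xs : List X) (x∈xs : x ∈ xs) → y ∈ xs → y ≢ x → y ∈ delete xs x∈xs
  ∈-delete (_ ∷ xs) (here refl) (here refl) y≢x = contradiction refl y≢x
  ∈-delete (_ ∷ xs) (here _) (there y∈xs) _ = y∈xs
  ∈-delete (_ ∷ xs) (there _) (here refl) _ = here refl
  ∈-delete (_ ∷ xs) (there x∈xs) (there y∈xs) y≢x = there (∈-delete xs x∈xs y∈xs y≢x)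

  unique-length-≤ : (xs ys : List X) → Unique xs → (∀ {x} → x ∈ xs → x ∈ ys) → length xs ≤ length ys
  unique-length-≤ [] ys _ _ = z≤n
  unique-length-≤ (x ∷ xs) ys (x∉xs ∷ unique) xs⊆ys = begin
    suc (length xs)                       ≤⟨ s≤s (unique-length-≤ xs (delete ys x∈ys) unique xs⊆rest) ⟩
    suc (length (delete ys x∈ys))         ≡⟨ length-delete ys x∈ys ⟩
    length ys                             ∎
    where
    open ≤-Reasoning
    x∈ys : x ∈ ys
    x∈ys = xs⊆ys (here refl)
    xs⊆rest : ∀ {y} → y ∈ xs → y ∈ delete ys x∈ys
    xs⊆rest y∈xs = ∈-delete ys x∈ys (xs⊆ys (there y∈xs)) (λ y≡x → All.lookup x∉xs y∈xs (sym y≡x))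

  AllPairs-lookup : {R : X → X → Set} {x y : X} (xs : List X) → AllPairs R xs → x ∈ xs → y ∈ xs → x ≢ y →
                    R x y ⊎ R y x
  AllPairs-lookup (_ ∷ xs) (_ ∷ _) (here refl) (here refl) x≢y = contradiction refl x≢y
  AllPairs-lookup (_ ∷ xs) (Rx ∷ _) (here refl) (there y∈xs) _ = inj₁ (All.lookup Rx y∈xs)
  AllPairs-lookup (_ ∷ xs) (Rx ∷ _) (there x∈xs) (here refl) _ = inj₂ (All.lookup Rx x∈xs)
  AllPairs-lookup (_ ∷ xs) (_ ∷ R-xs) (there x∈xs) (there y∈xs) x≢y = AllPairs-lookup xs R-xs x∈xs y∈xs x≢y

  pairs : List X → List (X × X)
  pairs [] = []
  pairs (x ∷ xs) = map (x ,_) xs ++ pairs xs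

  ∈-pairs : {x y : X} (xs : List X) → x ∈ xs → y ∈ xs → x ≢ y → (x , y) ∈ pairs xs ⊎ (y , x) ∈ pairs xs
  ∈-pairs (_ ∷ xs) (here refl) (here refl) x≢y = contradiction refl x≢y
  ∈-pairs (x ∷ xs) (here refl) (there y∈xs) _ = inj₁ (∈-++⁺ˡ (∈-map⁺ (x ,_) y∈xs))
  ∈-pairs (y ∷ xs) (there x∈xs) (here refl) _ = inj₂ (∈-++⁺ˡ (∈-map⁺ (y ,_) x∈xs))
  ∈-pairs (z ∷ xs) (there x∈xs) (there y∈xs) x≢y =
    Sum.map (∈-++⁺ʳ (map (z ,_) xs)) (∈-++⁺ʳ (map (z ,_) xs)) (∈-pairs xs x∈xs y∈xs x≢y)

  length-pairs : (xs : List X) → 2 * length (pairs xs) ≤ length xs * length xs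
  length-pairs [] = z≤n
  length-pairs (x ∷ xs) = begin
    2 * length (map (x ,_) xs ++ pairs xs)    ≡⟨ cong (2 *_) (length-++ (map (x ,_) xs)) ⟩
    2 * (length (map (x ,_) xs) + p)          ≡⟨ cong (λ l → 2 * (l + p)) (length-map (x ,_) xs) ⟩
    2 * (k + p)                               ≡⟨ *-distribˡ-+ 2 k p ⟩
    2 * k + 2 * p                             ≤⟨ +-monoʳ-≤ (2 * k) (length-pairs xs) ⟩
    2 * k + k * k                             <⟨ n<1+n _ ⟩
    suc (2 * k + k * k)                       ≡⟨ square-suc k ⟩
    suc k * suc k                             ∎
    where
    open ≤-Reasoning
    k = length xs
    p = length (pairs xs)
    square-suc : ∀ k → suc (2 * k + k * k) ≡ suc k * suc k
    square-suc = solve-∀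

  length-concatMap-≤ : ∀ {Y : Set} {c} (f : X → List Y) → (∀ x → length (f x) ≤ c) →
                       (xs : List X) → length (concatMap f xs) ≤ c * length xs
  length-concatMap-≤ f bound [] = z≤n
  length-concatMap-≤ {c = c} f bound (x ∷ xs) = begin
    length (f x ++ concatMap f xs)            ≡⟨ length-++ (f x) ⟩
    length (f x) + length (concatMap f xs)    ≤⟨ +-mono-≤ (bound x) (length-concatMap-≤ f bound xs) ⟩
    c + c * length xs                         ≡⟨ sym (*-suc c (length xs)) ⟩
    c * suc (length xs)                       ∎
    where open ≤-Reasoning

  find-just : {P : Pred X 0ℓ} (P? : Decidable P) (xs : List X) → Any P xs →
              ∃[ x ] find P? xs ≡ just x × x ∈ xs × P x
  find-just P? (x ∷ xs) any with P? x
  ... | yes Px = x , refl , here refl , Px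
  find-just P? (x ∷ xs) (here Px) | no ¬Px = contradiction Px ¬Px
  find-just P? (x ∷ xs) (there any) | no _ with find-just P? xs any
  ... | y , found , y∈xs , Py = y , found , there y∈xs , Py

both-two : ∀ x y → x ≢ 0 → x ≢ 1 → y ≢ 0 → y ≢ 1 → x + y ≤ 4 → x ≡ 2 × y ≡ 2
both-two 0 _ x≢0 _ _ _ _ = contradiction refl x≢0
both-two 1 _ _ x≢1 _ _ _ = contradiction refl x≢1
both-two _ 0 _ _ y≢0 _ _ = contradiction refl y≢0
both-two _ 1 _ _ _ y≢1 _ = contradiction refl y≢1
both-two 2 2 _ _ _ _ _ = refl , refl
both-two 2 (suc (suc (suc _))) _ _ _ _ (s≤s (s≤s (s≤s (s≤s ()))))
both-two (suc (suc (suc a))) (suc (suc b)) _ _ _ _ (s≤s (s≤s (s≤s a+2+b≤1))) =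
  absurd (2+b≰1 (≤-trans (m≤n+m (suc (suc b)) a) a+2+b≤1))
  where
  2+b≰1 : suc (suc b) ≤ 1 → Empty
  2+b≰1 (s≤s ())

module Covering {n : ℕ} (A A0 : List (Subset n))
  (sizes : All (λ s → ∣ s ∣ ≡ 4) A) (A-unique : Unique A) (independent : Independent A)
  (A0⊆A : ∀ {x} → x ∈ A0 → x ∈ A) (A0-unique : Unique A0) (A0-disjoint : PairwiseDisjoint A0) where

  A2 : List (Subset n)
  A2 = A₂ A A0

  size : ∀ {x} → x ∈ A → ∣ x ∣ ≡ 4
  size = All.lookup sizes

  disjoint : ∀ {a b} → a ∈ A0 → b ∈ A0 → a ≢ b → a ∩ b ≡ ⊥
  disjoint {a} {b} a∈A0 b∈A0 a≢b with AllPairs-lookup A0 A0-disjoint a∈A0 b∈A0 a≢b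
  ... | inj₁ ∣a∩b∣≡0 = ∣p∣≡0⇒p≡⊥ (a ∩ b) ∣a∩b∣≡0
  ... | inj₂ ∣b∩a∣≡0 = ∣p∣≡0⇒p≡⊥ (a ∩ b) (trans (cong ∣_∣ (∩-comm a b)) ∣b∩a∣≡0)

  meets? : (v : Subset n) → Decidable (λ w → ∣ v ∩ w ∣ ≢ 0)
  meets? v w = ¬? (∣ v ∩ w ∣ ≟ 0)

  ∈A₂⁻ : ∀ {v} → v ∈ A2 → v ∈ A × hits v A0 ≡ 2
  ∈A₂⁻ v∈A2 with ∈-filter⁻ _ {xs = A} v∈A2
  ... | v∈A , _ , hits≡2 = v∈A , hits≡2

  record Sides (v u w : Subset n) : Set where
    field
      u∈A0 : u ∈ A0
      w∈A0 : w ∈ A0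
      u≢w : u ≢ w
      ∣v∩u∣≡2 : ∣ v ∩ u ∣ ≡ 2
      ∣v∩w∣≡2 : ∣ v ∩ w ∣ ≡ 2
      v⊆u∪w : v ⊆ u ∪ w
      only : ∀ {s} → s ∈ A0 → ∣ v ∩ s ∣ ≢ 0 → s ≡ u ⊎ s ≡ w
  open Sides

  swap : ∀ {v u w} → Sides v u w → Sides v w u
  swap {v} {u} {w} S = record
    { u∈A0 = w∈A0 S ; w∈A0 = u∈A0 S ; u≢w = λ w≡u → u≢w S (sym w≡u)
    ; ∣v∩u∣≡2 = ∣v∩w∣≡2 S ; ∣v∩w∣≡2 = ∣v∩u∣≡2 S
    ; v⊆u∪w = subst (v ⊆_) (∪-comm u w) (v⊆u∪w S)
    ; only = λ s∈A0 meets → Sum.swap (only S s∈A0 meets) }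

  orient : ∀ {r a b u} → Sides r a b → u ≡ a ⊎ u ≡ b → ∃[ x ] Sides r u x
  orient {b = b} S (inj₁ refl) = b , S
  orient {a = a} S (inj₂ refl) = a , swap S

  sides : ∀ {v} → v ∈ A2 → ∃[ u ] ∃[ w ] Sides v u w
  sides {v} v∈A2 with ∈A₂⁻ v∈A2
  ... | v∈A , hits≡2 with filter (meets? v) A0 in met | hits≡2 | UniqueP.filter⁺ (meets? v) A0-unique
  ... | a ∷ b ∷ [] | _ | (a≢b ∷ []) ∷ _ = a , b , record
    { u∈A0 = a∈A0 ; w∈A0 = b∈A0 ; u≢w = a≢b ; ∣v∩u∣≡2 = proj₁ twos ; ∣v∩w∣≡2 = proj₂ twos
    ; v⊆u∪w = ∣p∩q∣≡∣p∣⇒p⊆q v (a ∪ b)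
                (trans (sym split) (trans (cong₂ _+_ (proj₁ twos) (proj₂ twos)) (sym (size v∈A))))
    ; only = only′ }
    where
    met-spec : ∀ {s} → s ∈ a ∷ b ∷ [] → s ∈ A0 × ∣ v ∩ s ∣ ≢ 0
    met-spec s∈met = ∈-filter⁻ (meets? v) {xs = A0} (subst (_ ∈_) (sym met) s∈met)
    a∈A0 = proj₁ (met-spec (here refl))
    b∈A0 = proj₁ (met-spec (there (here refl)))
    split : ∣ v ∩ a ∣ + ∣ v ∩ b ∣ ≡ ∣ v ∩ (a ∪ b) ∣
    split = ∣v∩u∣+∣v∩w∣≡∣v∩[u∪w]∣ v a b (disjoint a∈A0 b∈A0 a≢b)
    twos : ∣ v ∩ a ∣ ≡ 2 × ∣ v ∩ b ∣ ≡ 2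
    twos = both-two _ _ (proj₂ (met-spec (here refl))) (independent v∈A (A0⊆A a∈A0))
                        (proj₂ (met-spec (there (here refl)))) (independent v∈A (A0⊆A b∈A0))
                        (≤-trans (≤-reflexive split) (≤-trans (∣p∩q∣≤∣p∣ v (a ∪ b)) (≤-reflexive (size v∈A))))
    only′ : ∀ {s} → s ∈ A0 → ∣ v ∩ s ∣ ≢ 0 → s ≡ a ⊎ s ≡ b
    only′ {s} s∈A0 meets with subst (s ∈_) met (∈-filter⁺ (meets? v) s∈A0 meets)
    ... | here s≡a = inj₁ s≡a
    ... | there (here s≡b) = inj₂ s≡b

  2≢0 : ∀ {k} → k ≡ 2 → k ≢ 0
  2≢0 refl ()

  representative : Subset n → Subset n
  representative u = fromMaybe ⊥ (find (λ r → meets? r u) A2)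

  representative-spec : ∀ {u v} → v ∈ A2 → ∣ v ∩ u ∣ ≢ 0 →
                        representative u ∈ A2 × ∣ representative u ∩ u ∣ ≢ 0
  representative-spec {u} v∈A2 meets
    with find-just (λ r → meets? r u) A2 (lose v∈A2 meets)
  ... | r , found , r∈A2 , r-meets rewrite found = r∈A2 , r-meets

  hull : Subset n → Subset n
  hull r = ⋃ (take 2 (filter (meets? r) A0))

  ∣hull∣≤8 : ∀ r → ∣ hull r ∣ ≤ 8
  ∣hull∣≤8 r = ≤-trans (∣⋃∣≤ _ (AllP.take⁺ 2 (AllP.filter⁺ (meets? r) A0-sizes)))
                       (*-monoʳ-≤ 4 (≤-trans (≤-reflexive (length-take 2 met)) (m⊓n≤m 2 (length met))))
    where
    met : List (Subset n)
    met = filter (meets? r) A0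
    A0-sizes : All (λ s → ∣ s ∣ ≤ 4) A0
    A0-sizes = All.tabulate (λ s∈A0 → ≤-reflexive (size (A0⊆A s∈A0)))

  met⊆hull : ∀ {r s} → r ∈ A2 → s ∈ A0 → ∣ r ∩ s ∣ ≢ 0 → s ⊆ hull r
  met⊆hull {r} {s} r∈A2 s∈A0 meets = ⊆⋃ _ (subst (s ∈_) (sym all-taken) (∈-filter⁺ (meets? r) s∈A0 meets))
    where
    all-taken : take 2 (filter (meets? r) A0) ≡ filter (meets? r) A0
    all-taken = take-all 2 (filter (meets? r) A0) (≤-reflexive (proj₂ (∈A₂⁻ r∈A2)))

  sides⊆hull : ∀ {r u x} → r ∈ A2 → Sides r u x → u ∪ x ⊆ hull r
  sides⊆hull {r} {u} {x} r∈A2 S y∈u∪x with x∈p∪q⁻ u x y∈u∪x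
  ... | inj₁ y∈u = met⊆hull r∈A2 (u∈A0 S) (2≢0 (∣v∩u∣≡2 S)) y∈u
  ... | inj₂ y∈x = met⊆hull r∈A2 (w∈A0 S) (2≢0 (∣v∩w∣≡2 S)) y∈x

  canonical : Subset n → List (Subset n)
  canonical u = (representative u ∩ u) ∷ (u ─ (representative u ∩ u)) ∷ []

  -- Let x be the
  -- other side of r.  If x = w, then v ⊆ u ∪ x ⊆ hull r.  Otherwise v and r
  -- meet only inside u, so independence and two-subsets apply to their traces.
  trace-dichotomy : ∀ {v u w} → v ∈ A2 → Sides v u w → v ∩ u ∈ canonical u ⊎ v ⊆ hull (representative u)
  trace-dichotomy {v} {u} {w} v∈A2 S = compare (subset-≟ x w)
    where
    r = representative u
    r-spec = representative-spec v∈A2 (2≢0 (∣v∩u∣≡2 S))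
    r∈A2 = proj₁ r-spec
    r-sides = proj₂ (proj₂ (sides r∈A2))
    oriented = orient r-sides (only r-sides (u∈A0 S) (proj₂ r-spec))
    x = proj₁ oriented
    R : Sides r u x
    R = proj₂ oriented
    compare : Dec (x ≡ w) → v ∩ u ∈ canonical u ⊎ v ⊆ hull r
    compare (yes x≡w) = inj₂ (⊆-trans (v⊆u∪w S) (subst (λ t → u ∪ t ⊆ hull r) x≡w (sides⊆hull r∈A2 R)))
    compare (no x≢w) with two-subsets u (v ∩ u) (r ∩ u) (p∩q⊆q v u) (p∩q⊆q r u)
                            (size (A0⊆A (u∈A0 S))) (∣v∩u∣≡2 S) (∣v∩u∣≡2 R) ≢1
      where
      w∩x≡⊥ : w ∩ x ≡ ⊥
      w∩x≡⊥ = disjoint (w∈A0 S) (w∈A0 R) (λ w≡x → x≢w (sym w≡x))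
      ≢1 : ∣ (v ∩ u) ∩ (r ∩ u) ∣ ≢ 1
      ≢1 = subst (λ p → ∣ p ∣ ≢ 1) (sym (meet-inside v r u w x (v⊆u∪w S) (v⊆u∪w R) w∩x≡⊥))
             (independent (proj₁ (∈A₂⁻ v∈A2)) (proj₁ (∈A₂⁻ r∈A2)))
    ... | inj₁ same = inj₁ (here same)
    ... | inj₂ complement = inj₁ (there (here complement))

  joins : Subset n × Subset n → List (Subset n)
  joins (a , b) = cartesianProductWith _∪_ (canonical a) (canonical b)

  good : List (Subset n)
  good = concatMap joins (pairs A0)

  near : Subset n → List (Subset n)
  near u = subsetsOf (hull (representative u))

  bad : List (Subset n)
  bad = concatMap near A0

  ∈joins : ∀ {v a b} → Sides v a b → v ∩ a ∈ canonical a → v ∩ b ∈ canonical b → (a , b) ∈ pairs A0 →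
           v ∈ good
  ∈joins {v} {a} {b} S trace-a trace-b ab∈pairs = ∈-concatMap⁺ joins (lose ab∈pairs v∈joins)
    where
    v∈joins : v ∈ joins (a , b)
    v∈joins = subst (_∈ joins (a , b)) (sym (traces-cover v a b (v⊆u∪w S)))
                    (∈-cartesianProductWith⁺ _∪_ trace-a trace-b)

  ∈good : ∀ {v u w} → Sides v u w → v ∩ u ∈ canonical u → v ∩ w ∈ canonical w → v ∈ good
  ∈good S trace-u trace-w with ∈-pairs A0 (u∈A0 S) (w∈A0 S) (u≢w S)
  ... | inj₁ uw∈pairs = ∈joins S trace-u trace-w uw∈pairs
  ... | inj₂ wu∈pairs = ∈joins (swap S) trace-w trace-u wu∈pairs

  ∈bad : ∀ {v u} → u ∈ A0 → v ⊆ hull (representative u) → v ∈ bad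
  ∈bad {v} u∈A0 v⊆hull = ∈-concatMap⁺ near (lose u∈A0 (∈-subsetsOf v _ v⊆hull))

  A₂⊆good++bad : ∀ {v} → v ∈ A2 → v ∈ good ++ bad
  A₂⊆good++bad v∈A2 with sides v∈A2
  ... | u , w , S with trace-dichotomy v∈A2 S | trace-dichotomy v∈A2 (swap S)
  ... | inj₂ v⊆hull | _ = ∈-++⁺ʳ good (∈bad (u∈A0 S) v⊆hull)
  ... | inj₁ _ | inj₂ v⊆hull = ∈-++⁺ʳ good (∈bad (w∈A0 S) v⊆hull)
  ... | inj₁ trace-u | inj₁ trace-w = ∈-++⁺ˡ (∈good S trace-u trace-w)

  -- Four joins for each of the at most k²/2 pairs.
  length-good : length good ≤ 2 * (length A0 * length A0)
  length-good = begin
    length good                       ≤⟨ length-concatMap-≤ joins (λ _ → ≤-refl) (pairs A0) ⟩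
    4 * length (pairs A0)             ≡⟨ *-assoc 2 2 (length (pairs A0)) ⟩
    2 * (2 * length (pairs A0))       ≤⟨ *-monoʳ-≤ 2 (length-pairs A0) ⟩
    2 * (length A0 * length A0)       ∎
    where open ≤-Reasoning

  -- At most 2⁸ subsets of a hull for each member of A0.
  length-bad : length bad ≤ 256 * length A0
  length-bad = length-concatMap-≤ near (λ u → ≤-trans (≤-reflexive (length-subsetsOf (hull (representative u))))
                                                   (^-monoʳ-≤ 2 (∣hull∣≤8 (representative u)))) A0

  length-A₂ : length A2 ≤ 2 * (length A0 * length A0) + 256 * length A0
  length-A₂ = begin
    length A2                  ≤⟨ unique-length-≤ A2 (good ++ bad) (UniqueP.filter⁺ _ A-unique) A₂⊆good++bad ⟩
    length (good ++ bad)       ≡⟨ length-++ good ⟩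
    length good + length bad   ≤⟨ +-mono-≤ length-good length-bad ⟩
    2 * (length A0 * length A0) + 256 * length A0 ∎
    where open ≤-Reasoning

-- For n ≥ 64(m+1) the linear term is absorbed: if a ≤ 2k² + 256k and
-- 4k ≤ n then (m+1)·a ≤ (m+1)·2k² + n².
absorb : ∀ m k a n → a ≤ 2 * (k * k) + 256 * k → 4 * k ≤ n → 64 * suc m ≤ n →
         suc m * a ≤ suc m * (2 * (k * k)) + n * n
absorb m k a n a≤ 4k≤n N≤n = begin
  suc m * a                                          ≤⟨ *-monoʳ-≤ (suc m) a≤ ⟩
  suc m * (2 * (k * k) + 256 * k)                    ≡⟨ split-linear m k ⟩
  suc m * (2 * (k * k)) + (64 * suc m) * (4 * k)     ≤⟨ +-monoʳ-≤ (suc m * (2 * (k * k))) (*-mono-≤ N≤n 4k≤n) ⟩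
  suc m * (2 * (k * k)) + n * n                      ∎
  where
  open ≤-Reasoning
  split-linear : ∀ m k → suc m * (2 * (k * k) + 256 * k) ≡ suc m * (2 * (k * k)) + (64 * suc m) * (4 * k)
  split-linear = solve-∀

lemma5 : (m : ℕ) → ∃[ N ] ((n : ℕ) → N ≤ n →
           (A A0 : List (Subset n)) → IsFamily A → Independent A →
           IsMaxDisjoint A0 A →
           suc m * length (A₂ A A0) ≤ suc m * (2 * (length A0 * length A0)) + n * n)
lemma5 m = 64 * suc m , bound
  where
  bound : (n : ℕ) → 64 * suc m ≤ n → (A A0 : List (Subset n)) → IsFamily A → Independent A →
          IsMaxDisjoint A0 A → suc m * length (A₂ A A0) ≤ suc m * (2 * (length A0 * length A0)) + n * n
  bound n N≤n A A0 (sizes , A-unique) independent ((A0-unique , A0⊆A) , A0-disjoint , _) =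
    absorb m (length A0) (length (A₂ A A0)) n
      (Covering.length-A₂ A A0 sizes A-unique independent A0⊆A A0-unique A0-disjoint)
      (disjoint-family-bound A0 A0-disjoint (All.tabulate (λ s∈A0 → All.lookup sizes (A0⊆A s∈A0))))
      N≤n
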